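{- Let $n\ge 0$, let $a,b$ be integers with $a > b \ge 0$ and $a,b$ not both even, and let $\mathscr{S} = \{x+yi \in \mathbb{Z}[i] : 0 \le x < a,\ 0 \le y < a-x\}$. If $\mathscr{S} \subset \bigcup_{z\in\mathbb{Z}[i]} (B_n + (a+bi)z)$, then every residue class of $\mathbb{Z}[i]/(a+bi)$ has a representative in $B_n$.
   Context: For $n\ge 0$, $B_n = \left\{ \sum_{j=0}^n v_j (1+i)^j : v_j \in \{0,\pm 1,\pm i\}\right\} \subset \mathbb{Z}[i]$. For a set $X$ and $w\in\mathbb{Z}[i]$, $X + w = \{x+w : x\in X\}$. -}

module Defs where

open import Data.Integer using (ℤ; +_; -_; _+_; _*_; _-_; _≤_; _<_)
open import Data.Integer.Divisibility using (_∣_)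
open import Data.Nat using (ℕ; zero; suc)
open import Data.Vec using (Vec; []; _∷_)
open import Data.Product using (_×_; _,_; Σ; ∃)
open import Relation.Binary.PropositionalEquality using (_≡_)
open import Relation.Nullary using (¬_)

record ℤ[i] : Set where
  constructor _+_i
  field
    re : ℤ
    im : ℤ
open ℤ[i] public

infixl 6 _⊕_
infixl 7 _⊗_

_⊕_ : ℤ[i] → ℤ[i] → ℤ[i]
(a + b i) ⊕ (c + d i) = (a + c) + (b + d) i

_⊗_ : ℤ[i] → ℤ[i] → ℤ[i]
(a + b i) ⊗ (c + d i) = (a * c - b * d) + (a * d + b * c) i

onePlusI : ℤ[i]
onePlusI = (+ 1) + (+ 1) i

data Digit : Set where
  d0 d1 dm1 di dmi : Digit

digitVal : Digit → ℤ[i]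
digitVal d0  = (+ 0) + (+ 0) i
digitVal d1  = (+ 1) + (+ 0) i
digitVal dm1 = (- (+ 1)) + (+ 0) i
digitVal di  = (+ 0) + (+ 1) i
digitVal dmi = (+ 0) + (- (+ 1)) i

-- evalDigits [v₀, v₁, …, v_k] = Σ_j v_j (1+i)^j   (Horner form)
evalDigits : ∀ {k} → Vec Digit k → ℤ[i]
evalDigits []       = (+ 0) + (+ 0) i
evalDigits (v ∷ vs) = digitVal v ⊕ onePlusI ⊗ evalDigits vs

InB : ℕ → ℤ[i] → Set
InB n w = Σ (Vec Digit (suc n)) λ v → evalDigits v ≡ w

InCoverB : ℕ → ℤ[i] → ℤ[i] → Set
InCoverB n m w = Σ ℤ[i] λ β → Σ ℤ[i] λ z → InB n β × (β ⊕ m ⊗ z ≡ w)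

HasRepB : ℕ → ℤ[i] → ℤ[i] → Set
HasRepB n m w = Σ ℤ[i] λ β → Σ ℤ[i] λ z → InB n β × (w ≡ β ⊕ m ⊗ z)

{-# OPTIONS --safe #-}
module Submission where

-- Write m = a + b i and N = a² + b². Rounding both coordinates of w m̄ / N to the nearest integer
-- gives w ≡ e (mod m) with N e = m (s + t i) and |s|, |t| ≤ N / 2, i.e. e lies in the closed square
-- with vertices m (±1 ± i) / 2. Multiplication by i preserves this square, B_n and the ideal (m),
-- so e may be rotated into the closed first quadrant. There the square lies inside the triangle 𝒮
-- except for its vertex m (1 + i) / 2, which is a Gaussian integer only when a and b are both odd.
-- In that case e − 1 ∈ 𝒮 is covered: e − 1 = v₀ + (1 + i) γ + m z with v₀ a digit. Reducing modulo
-- 1 + i, which divides m, shows v₀ = 0, so replacing v₀ by 1 gives a representative of e in B_n.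

open import Defs
open import Data.Nat using (ℕ; z≤n)
import Data.Nat as ℕ
open import Data.Integer using (ℤ; +_; +[1+_]; -[1+_]; -_; _+_; _*_; _-_; _≤_; _<_; +≤+; +<+; _/_; _%_)
import Data.Integer.Properties as ℤ
open import Data.Integer.DivMod using (a≡a%n+[a/n]*n; n%d<d)
open import Data.Integer.Divisibility using (_∣_)
import Data.Integer.Divisibility.Signed as Signed
open import Data.Integer.Tactic.RingSolver using (solve)
open import Data.List using (_∷_; [])
open import Data.Vec using (Vec)
-- Qualified, since an ambiguous _∷_ breaks the variable lists passed to solve.
import Data.Vec as Vec
open import Data.Product using (Σ; _×_; _,_; proj₁; proj₂)
open import Data.Sum using (_⊎_; inj₁; inj₂)
open import Data.Empty using (⊥-elim)
open import Relation.Nullary using (¬_; yes; no)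
open import Relation.Binary.PropositionalEquality

-- Linear arithmetic by certificate: L ≡ R follows from hypotheses Aₖ ≡ Bₖ once
-- L − R = Σ uₖ (Aₖ − Bₖ) is verified as a ring identity (by the solver, at the use site).
by-combination₁ : ∀ {L R A B} u → A ≡ B → L - R ≡ u * (A - B) → L ≡ R
by-combination₁ {L} {R} {A} u refl identity = ℤ.i-j≡0⇒i≡j L R (trans identity (solve (u ∷ A ∷ [])))

by-combination₂ : ∀ {L R A B C D} u v → A ≡ B → C ≡ D → L - R ≡ u * (A - B) + v * (C - D) → L ≡ R
by-combination₂ {L} {R} {A} {_} {C} u v refl refl identity =
  ℤ.i-j≡0⇒i≡j L R (trans identity (solve (u ∷ A ∷ v ∷ C ∷ [])))

by-combination₃ : ∀ {L R A B C D E F} u v w → A ≡ B → C ≡ D → E ≡ F →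
                  L - R ≡ u * (A - B) + v * (C - D) + w * (E - F) → L ≡ R
by-combination₃ {L} {R} {A} {_} {C} {_} {E} u v w refl refl refl identity =
  ℤ.i-j≡0⇒i≡j L R (trans identity (solve (u ∷ A ∷ v ∷ C ∷ w ∷ E ∷ [])))

≤-by-difference : ∀ {i j d} → + 0 ≤ d → d ≡ j - i → i ≤ j
≤-by-difference 0≤d refl = ℤ.0≤i-j⇒j≤i 0≤d

<-by-difference : ∀ {i j d} → + 0 ≤ d → d ≡ j - (+ 1 + i) → i < j
<-by-difference 0≤d d≡j-[1+i] = ℤ.suc[i]≤j⇒i<j (≤-by-difference 0≤d d≡j-[1+i])

i<j⇒0≤j-[1+i] : ∀ {i j} → i < j → + 0 ≤ j - (+ 1 + i)
i<j⇒0≤j-[1+i] i<j = ℤ.i≤j⇒0≤j-i (ℤ.i<j⇒suc[i]≤j i<j)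

0≤+ : ∀ k → + 0 ≤ + k
0≤+ k = +≤+ z≤n

0≤i+j : ∀ {i j} → + 0 ≤ i → + 0 ≤ j → + 0 ≤ i + j
0≤i+j = ℤ.+-mono-≤

0≤i*j : ∀ {i j} → + 0 ≤ i → + 0 ≤ j → + 0 ≤ i * j
0≤i*j {+ m} {+ n} _ _ = subst (+ 0 ≤_) (ℤ.pos-* m n) (0≤+ (m ℕ.* n))

0≰i⇒0≤-i : ∀ {i} → ¬ (+ 0 ≤ i) → + 0 ≤ - i
0≰i⇒0≤-i 0≰i = ℤ.<⇒≤ (ℤ.neg-mono-< (ℤ.≰⇒> 0≰i))

nonneg-sum-zero : ∀ {i j} → + 0 ≤ i → + 0 ≤ j → i + j ≡ + 0 → i ≡ + 0 × j ≡ + 0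
nonneg-sum-zero {i} {j} 0≤i 0≤j i+j≡0 =
  left-zero 0≤i 0≤j i+j≡0 , left-zero 0≤j 0≤i (trans (ℤ.+-comm j i) i+j≡0)
  where
  left-zero : ∀ {k l} → + 0 ≤ k → + 0 ≤ l → k + l ≡ + 0 → k ≡ + 0
  left-zero {k} {l} 0≤k 0≤l k+l≡0 =
    ℤ.≤-antisym (≤-by-difference 0≤l (by-combination₁ (+ 1) k+l≡0 (solve (k ∷ l ∷ [])))) 0≤k

nonneg-sum₃-zero : ∀ {i j k} → + 0 ≤ i → + 0 ≤ j → + 0 ≤ k → i + j + k ≡ + 0 →
                   i ≡ + 0 × j ≡ + 0 × k ≡ + 0
nonneg-sum₃-zero 0≤i 0≤j 0≤k i+j+k≡0 =
  let i+j≡0 , k≡0 = nonneg-sum-zero (0≤i+j 0≤i 0≤j) 0≤k i+j+k≡0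
      i≡0 , j≡0   = nonneg-sum-zero 0≤i 0≤j i+j≡0
  in i≡0 , j≡0 , k≡0

*-cancelˡ-≡-pos : ∀ {c i j} → + 0 < c → c * i ≡ c * j → i ≡ j
*-cancelˡ-≡-pos {c@(+[1+ _ ])} {i} {j} _ = ℤ.*-cancelˡ-≡ c i j
*-cancelˡ-≡-pos {+ 0} (+<+ ()) _
*-cancelˡ-≡-pos { -[1+ _ ]} () _

pos*i≡0⇒i≡0 : ∀ {c i} → + 0 < c → c * i ≡ + 0 → i ≡ + 0
pos*i≡0⇒i≡0 {c} 0<c c*i≡0 = *-cancelˡ-≡-pos 0<c (trans c*i≡0 (sym (ℤ.*-zeroʳ c)))

Balanced : ℤ → ℤ → Set
Balanced N r = - N ≤ + 2 * r × + 2 * r ≤ N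

BalancedDivMod : ℤ → ℤ → Set
BalancedDivMod N x = Σ ℤ λ q → Σ ℤ λ r → x ≡ r + q * N × Balanced N r

Balanced-neg : ∀ {N r} → Balanced N r → Balanced N (- r)
Balanced-neg {N} {r} (-N≤2r , 2r≤N) =
  ≤-by-difference (ℤ.i≤j⇒0≤j-i 2r≤N) (solve (N ∷ r ∷ [])) ,
  ≤-by-difference (ℤ.i≤j⇒0≤j-i -N≤2r) (solve (N ∷ r ∷ []))

-- Floor division of 2x + N by 2N rounds x / N to the nearest integer.
rounded-quotient : ∀ N x q ρ → + 2 * x + N ≡ ρ + q * (+ 2 * N) → + 0 ≤ ρ → ρ < + 2 * N →
                   BalancedDivMod N x
rounded-quotient N x q ρ division 0≤ρ ρ<2N = q , x - q * N , solve (x ∷ q ∷ N ∷ []) ,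
  ≤-by-difference 0≤ρ (by-combination₁ (- + 1) division (solve (N ∷ x ∷ q ∷ ρ ∷ []))) ,
  ≤-by-difference (ℤ.i≤j⇒0≤j-i (ℤ.<⇒≤ ρ<2N))
                  (by-combination₁ (+ 1) division (solve (N ∷ x ∷ q ∷ ρ ∷ [])))

balanced-divMod : ∀ {N} → + 0 < N → ∀ x → BalancedDivMod N x
balanced-divMod {N@(+[1+ _ ])} _ x =
  rounded-quotient N x ((+ 2 * x + N) / (+ 2 * N)) _
    (a≡a%n+[a/n]*n (+ 2 * x + N) (+ 2 * N)) (0≤+ _) (+<+ (n%d<d (+ 2 * x + N) (+ 2 * N)))
balanced-divMod {+ 0} (+<+ ()) _
balanced-divMod { -[1+ _ ]} () _

mulI : ℤ[i] → ℤ[i]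
mulI (x + y i) = (- y) + x i

mulI⁴ : ∀ u → mulI (mulI (mulI (mulI u))) ≡ u
mulI⁴ (x + y i) = cong₂ _+_i (ℤ.neg-involutive x) (ℤ.neg-involutive y)

mulI-⊕-⊗ : ∀ u m z → mulI (u ⊕ m ⊗ z) ≡ mulI u ⊕ m ⊗ mulI z
mulI-⊕-⊗ (x + y i) (p + q i) (z + w i) = cong₂ _+_i re-part im-part
  where
  re-part : - (y + (p * w + q * z)) ≡ - y + (p * - w - q * z)
  re-part = solve (y ∷ p ∷ q ∷ z ∷ w ∷ [])
  im-part : x + (p * z - q * w) ≡ x + (p * z + q * - w)
  im-part = solve (x ∷ p ∷ q ∷ z ∷ w ∷ [])

⊕-⊗-shift : ∀ u m z q → (u ⊕ m ⊗ z) ⊕ m ⊗ q ≡ u ⊕ m ⊗ (z ⊕ q)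
⊕-⊗-shift (x + y i) (p + p' i) (z + z' i) (q + q' i) = cong₂ _+_i re-part im-part
  where
  re-part : (x + (p * z - p' * z')) + (p * q - p' * q') ≡ x + (p * (z + q) - p' * (z' + q'))
  re-part = solve (x ∷ p ∷ p' ∷ z ∷ z' ∷ q ∷ q' ∷ [])
  im-part : (y + (p * z' + p' * z)) + (p * q' + p' * q) ≡ y + (p * (z' + q') + p' * (z + q))
  im-part = solve (y ∷ p ∷ p' ∷ z ∷ z' ∷ q ∷ q' ∷ [])

rotateDigit : Digit → Digit
rotateDigit d0  = d0
rotateDigit d1  = di
rotateDigit di  = dm1
rotateDigit dm1 = dmi
rotateDigit dmi = d1

digitVal-rotate : ∀ d → digitVal (rotateDigit d) ≡ mulI (digitVal d)
digitVal-rotate d0  = refl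
digitVal-rotate d1  = refl
digitVal-rotate dm1 = refl
digitVal-rotate di  = refl
digitVal-rotate dmi = refl

evalDigits-rotate : ∀ {k} (v : Vec Digit k) → evalDigits (Vec.map rotateDigit v) ≡ mulI (evalDigits v)
evalDigits-rotate Vec.[]       = refl
evalDigits-rotate (d Vec.∷ v) = begin
  digitVal (rotateDigit d) ⊕ onePlusI ⊗ evalDigits (Vec.map rotateDigit v)
    ≡⟨ cong₂ (λ u w → u ⊕ onePlusI ⊗ w) (digitVal-rotate d) (evalDigits-rotate v) ⟩
  mulI (digitVal d) ⊕ onePlusI ⊗ mulI (evalDigits v)
    ≡⟨ mulI-⊕-⊗ (digitVal d) onePlusI (evalDigits v) ⟨
  mulI (digitVal d ⊕ onePlusI ⊗ evalDigits v) ∎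
  where open ≡-Reasoning

module _ {n : ℕ} (m : ℤ[i]) where

  HasRepB-mulI : ∀ {w} → HasRepB n m w → HasRepB n m (mulI w)
  HasRepB-mulI (β , z , (v , refl) , w≡β+mz) =
    mulI β , mulI z , (Vec.map rotateDigit v , evalDigits-rotate v) ,
    trans (cong mulI w≡β+mz) (mulI-⊕-⊗ β m z)

  HasRepB-mulI⁻¹ : ∀ {w} → HasRepB n m (mulI w) → HasRepB n m w
  HasRepB-mulI⁻¹ {w} rep = subst (HasRepB n m) (mulI⁴ w) (HasRepB-mulI (HasRepB-mulI (HasRepB-mulI rep)))

  HasRepB-shift : ∀ {e} → HasRepB n m e → ∀ q → HasRepB n m (e ⊕ m ⊗ q)
  HasRepB-shift (β , z , β∈B , e≡β+mz) q =
    β , z ⊕ q , β∈B , trans (cong (_⊕ m ⊗ q) e≡β+mz) (⊕-⊗-shift β m z q)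

-- x + y i ↦ x + y is, modulo 2, the reduction ℤ[i] → ℤ[i] / (1 + i) ≅ 𝔽₂.
parity : ℤ[i] → ℤ
parity (x + y i) = x + y

parity-⊕ : ∀ u v → parity (u ⊕ v) ≡ parity u + parity v
parity-⊕ (x + y i) (z + w i) = interchange
  where
  interchange : (x + z) + (y + w) ≡ (x + y) + (z + w)
  interchange = solve (x ∷ y ∷ z ∷ w ∷ [])

parity-⊗ : ∀ u v → parity (u ⊗ v) ≡ parity u * parity v - + 2 * (im u * im v)
parity-⊗ (x + y i) (z + w i) = expand
  where
  expand : (x * z - y * w) + (x * w + y * z) ≡ (x + y) * (z + w) - + 2 * (y * w)
  expand = solve (x ∷ y ∷ z ∷ w ∷ [])

even-parity-⊗ : ∀ u v → + 2 Signed.∣ parity u → + 2 Signed.∣ parity (u ⊗ v)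
even-parity-⊗ u v 2∣u = subst (+ 2 Signed.∣_) (sym (parity-⊗ u v))
  (Signed.∣m∣n⇒∣m-n (Signed.∣m⇒∣m*n (parity v) 2∣u) (Signed.∣m⇒∣m*n (im u * im v) Signed.∣-refl))

digit-zero-or-odd : ∀ d → d ≡ d0 ⊎ + 2 Signed.∣ parity (digitVal d) + + 1
digit-zero-or-odd d0  = inj₁ refl
digit-zero-or-odd d1  = inj₂ (Signed.divides (+ 1) refl)
digit-zero-or-odd dm1 = inj₂ (Signed.divides (+ 0) refl)
digit-zero-or-odd di  = inj₂ (Signed.divides (+ 1) refl)
digit-zero-or-odd dmi = inj₂ (Signed.divides (+ 0) refl)

-- Reduce v₀ + (1 + i) γ + m z = e − 1 modulo 1 + i: 1 + i and m (as a + b = 2y) vanish, e − 1 ↦ a − 1.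
corner-odd-digit⇒even : ∀ {a b x y d γ z} → x + y ≡ a → + 2 * x ≡ a - b →
                        (digitVal d ⊕ onePlusI ⊗ γ) ⊕ (a + b i) ⊗ z ≡ (x - + 1) + y i →
                        + 2 Signed.∣ parity (digitVal d) + + 1 → (+ 2 ∣ a) × (+ 2 ∣ b)
corner-odd-digit⇒even {a} {b} {x} {y} {d} {γ} {z} x+y≡a 2x≡a-b eq 2∣d+1 =
  Signed.∣⇒∣ᵤ 2∣a , Signed.∣⇒∣ᵤ 2∣b
  where
  m≡2y : a + b ≡ y * + 2
  m≡2y = by-combination₂ (- + 2) (+ 1) x+y≡a 2x≡a-b (solve (a ∷ b ∷ x ∷ y ∷ []))
  parity-sum : parity (digitVal d) + (parity (onePlusI ⊗ γ) + parity ((a + b i) ⊗ z)) ≡ (x - + 1) + y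
  parity-sum = begin
    parity (digitVal d) + (parity (onePlusI ⊗ γ) + parity ((a + b i) ⊗ z))
      ≡⟨ ℤ.+-assoc (parity (digitVal d)) _ _ ⟨
    parity (digitVal d) + parity (onePlusI ⊗ γ) + parity ((a + b i) ⊗ z)
      ≡⟨ cong (_+ parity ((a + b i) ⊗ z)) (parity-⊕ (digitVal d) (onePlusI ⊗ γ)) ⟨
    parity (digitVal d ⊕ onePlusI ⊗ γ) + parity ((a + b i) ⊗ z)
      ≡⟨ parity-⊕ (digitVal d ⊕ onePlusI ⊗ γ) ((a + b i) ⊗ z) ⟨
    parity ((digitVal d ⊕ onePlusI ⊗ γ) ⊕ (a + b i) ⊗ z)
      ≡⟨ cong parity eq ⟩
    (x - + 1) + y ∎
    where open ≡-Reasoning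
  odd-plus-even : ∀ p r → p + r ≡ (x - + 1) + y → (p + + 1) + r ≡ a
  odd-plus-even p r p+r≡ = by-combination₂ (+ 1) (+ 1) p+r≡ x+y≡a (solve (p ∷ r ∷ x ∷ y ∷ a ∷ []))
  2∣a : + 2 Signed.∣ a
  2∣a = subst (+ 2 Signed.∣_) (odd-plus-even (parity (digitVal d)) _ parity-sum)
    (Signed.∣m∣n⇒∣m+n 2∣d+1 (Signed.∣m∣n⇒∣m+n (even-parity-⊗ onePlusI γ Signed.∣-refl)
                                              (even-parity-⊗ (a + b i) z (Signed.divides y m≡2y))))
  a-2x≡b : a - + 2 * x ≡ b
  a-2x≡b = by-combination₁ (- + 1) 2x≡a-b (solve (a ∷ b ∷ x ∷ []))
  2∣b : + 2 Signed.∣ b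
  2∣b = subst (+ 2 Signed.∣_) a-2x≡b (Signed.∣m∣n⇒∣m-n 2∣a (Signed.∣m⇒∣m*n x Signed.∣-refl))

corner-lowest-digit≡d0 : ∀ {a b x y d γ z} → ¬ ((+ 2 ∣ a) × (+ 2 ∣ b)) → x + y ≡ a → + 2 * x ≡ a - b →
                         (digitVal d ⊕ onePlusI ⊗ γ) ⊕ (a + b i) ⊗ z ≡ (x - + 1) + y i → d ≡ d0
corner-lowest-digit≡d0 {d = d} {γ} {z} not-both-even x+y≡a 2x≡a-b eq with digit-zero-or-odd d
... | inj₁ d≡d0  = d≡d0
... | inj₂ 2∣d+1 =
  ⊥-elim (not-both-even (corner-odd-digit⇒even {d = d} {γ} {z} x+y≡a 2x≡a-b eq 2∣d+1))

raise-lowest-digit : ∀ {γ w x y} → (digitVal d0 ⊕ onePlusI ⊗ γ) ⊕ w ≡ (x - + 1) + y i →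
                     x + y i ≡ (digitVal d1 ⊕ onePlusI ⊗ γ) ⊕ w
raise-lowest-digit {g + h i} {p + q i} {x} {y} eq = cong₂ _+_i re-part (sym (cong im eq))
  where
  re-eq : (+ 0 + (+ 1 * g - + 1 * h)) + p ≡ x - + 1
  re-eq = cong re eq
  re-part : x ≡ (+ 1 + (+ 1 * g - + 1 * h)) + p
  re-part = by-combination₁ (- + 1) re-eq (solve (g ∷ h ∷ p ∷ x ∷ []))

-- e = m (s + t i) / N with N = a² + b² and |s|, |t| ≤ N / 2: the closed square with vertices m (±1 ± i) / 2.
record InSquare (a b : ℤ) (e : ℤ[i]) : Set where
  constructor square
  field
    s t        : ℤ
    re-eq      : (a * a + b * b) * re e ≡ a * s - b * t
    im-eq      : (a * a + b * b) * im e ≡ b * s + a * t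
    s-balanced : Balanced (a * a + b * b) s
    t-balanced : Balanced (a * a + b * b) t

-- The vertex m (1 + i) / 2 of the square.
Corner : ℤ → ℤ → ℤ[i] → Set
Corner a b e = re e + im e ≡ a × + 2 * re e ≡ a - b

InSquare-mulI : ∀ {a b e} → InSquare a b e → InSquare a b (mulI e)
InSquare-mulI {a} {b} {x + y i} (square s t re-eq im-eq s-balanced t-balanced) =
  square (- t) s re-eq′ im-eq′ (Balanced-neg t-balanced) s-balanced
  where
  re-eq′ : (a * a + b * b) * - y ≡ a * - t - b * s
  re-eq′ = by-combination₁ (- + 1) im-eq (solve (a ∷ b ∷ y ∷ s ∷ t ∷ []))
  im-eq′ : (a * a + b * b) * x ≡ b * - t + a * s
  im-eq′ = by-combination₁ (+ 1) re-eq (solve (a ∷ b ∷ x ∷ s ∷ t ∷ []))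

divide-into-square : ∀ a b → + 0 < a * a + b * b → (w : ℤ[i]) →
                     Σ ℤ[i] λ e → Σ ℤ[i] λ q → InSquare a b e × w ≡ e ⊕ (a + b i) ⊗ q
divide-into-square a b 0<N (x + y i) =
  divide (balanced-divMod 0<N (x * a + y * b)) (balanced-divMod 0<N (y * a - x * b))
  where
  divide : BalancedDivMod (a * a + b * b) (x * a + y * b) → BalancedDivMod (a * a + b * b) (y * a - x * b) →
           Σ ℤ[i] λ e → Σ ℤ[i] λ q → InSquare a b e × x + y i ≡ e ⊕ (a + b i) ⊗ q
  divide (q , s , eq₁ , s-balanced) (r , t , eq₂ , t-balanced) =
    (x - (a * q - b * r)) + (y - (a * r + b * q)) i , q + r i ,
    square s t re-eq im-eq s-balanced t-balanced , cong₂ _+_i re-part im-part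
    where
    re-eq : (a * a + b * b) * (x - (a * q - b * r)) ≡ a * s - b * t
    re-eq = by-combination₂ a (- b) eq₁ eq₂ (solve (a ∷ b ∷ x ∷ y ∷ q ∷ r ∷ s ∷ t ∷ []))
    im-eq : (a * a + b * b) * (y - (a * r + b * q)) ≡ b * s + a * t
    im-eq = by-combination₂ b a eq₁ eq₂ (solve (a ∷ b ∷ x ∷ y ∷ q ∷ r ∷ s ∷ t ∷ []))
    re-part : x ≡ (x - (a * q - b * r)) + (a * q - b * r)
    re-part = solve (a ∷ b ∷ x ∷ q ∷ r ∷ [])
    im-part : y ≡ (y - (a * r + b * q)) + (a * r + b * q)
    im-part = solve (a ∷ b ∷ y ∷ q ∷ r ∷ [])

module _ {a b : ℤ} (0≤b : + 0 ≤ b) (b<a : b < a) where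

  0<a-b : + 0 < a - b
  0<a-b = <-by-difference (i<j⇒0≤j-[1+i] b<a) (solve (a ∷ b ∷ []))

  0<a+b : + 0 < a + b
  0<a+b = <-by-difference (0≤i+j (i<j⇒0≤j-[1+i] b<a) (0≤i*j (0≤+ 2) 0≤b)) (solve (a ∷ b ∷ []))

  0<norm : + 0 < a * a + b * b
  0<norm = <-by-difference (0≤i+j (0≤i+j (0≤i*j 0≤a-1 0≤a-1) (0≤i*j (0≤+ 2) 0≤a-1)) (0≤i*j 0≤b 0≤b))
                           (solve (a ∷ b ∷ []))
    where
    0≤a-1 : + 0 ≤ a - + 1
    0≤a-1 = i<j⇒0≤j-[1+i] (ℤ.≤-<-trans 0≤b b<a)

  square-corner : ∀ {e} → InSquare a b e → a ≤ re e + im e → Corner a b e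
  square-corner {x + y i} (square s t re-eq im-eq (_ , 2s≤N) (_ , 2t≤N)) a≤x+y = x+y≡a , 2x≡a-b
    where
    excess : (a + b) * ((a * a + b * b) - + 2 * s) + (a - b) * ((a * a + b * b) - + 2 * t)
             + (+ 2 * (a * a + b * b)) * ((x + y) - a) ≡ + 0
    excess = by-combination₂ (+ 2) (+ 2) re-eq im-eq (solve (a ∷ b ∷ x ∷ y ∷ s ∷ t ∷ []))
    0<2N : + 0 < + 2 * (a * a + b * b)
    0<2N = ℤ.*-monoˡ-<-pos (+ 2) 0<norm
    summands-zero : (a + b) * ((a * a + b * b) - + 2 * s) ≡ + 0
                    × (a - b) * ((a * a + b * b) - + 2 * t) ≡ + 0
                    × (+ 2 * (a * a + b * b)) * ((x + y) - a) ≡ + 0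
    summands-zero = nonneg-sum₃-zero (0≤i*j (ℤ.<⇒≤ 0<a+b) (ℤ.i≤j⇒0≤j-i 2s≤N))
                                     (0≤i*j (ℤ.<⇒≤ 0<a-b) (ℤ.i≤j⇒0≤j-i 2t≤N))
                                     (0≤i*j (ℤ.<⇒≤ 0<2N) (ℤ.i≤j⇒0≤j-i a≤x+y)) excess
    x+y≡a : x + y ≡ a
    x+y≡a = ℤ.i-j≡0⇒i≡j (x + y) a (pos*i≡0⇒i≡0 0<2N (proj₂ (proj₂ summands-zero)))
    N-2s≡0 : (a * a + b * b) - + 2 * s ≡ + 0
    N-2s≡0 = pos*i≡0⇒i≡0 0<a+b (proj₁ summands-zero)
    N-2t≡0 : (a * a + b * b) - + 2 * t ≡ + 0
    N-2t≡0 = pos*i≡0⇒i≡0 0<a-b (proj₁ (proj₂ summands-zero))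
    2x≡a-b : + 2 * x ≡ a - b
    2x≡a-b = *-cancelˡ-≡-pos 0<norm
               (by-combination₃ (+ 2) (- a) b re-eq N-2s≡0 N-2t≡0 (solve (a ∷ b ∷ x ∷ s ∷ t ∷ [])))

below-diagonal : ∀ {a x y} → + 0 ≤ y → x + y < a → x < a × y < a - x
below-diagonal {a} {x} {y} 0≤y x+y<a =
  ℤ.≤-<-trans x≤x+y x+y<a , <-by-difference (i<j⇒0≤j-[1+i] x+y<a) (solve (a ∷ x ∷ y ∷ []))
  where
  x≤x+y : x ≤ x + y
  x≤x+y = ≤-by-difference 0≤y (solve (x ∷ y ∷ []))

TriangleCovered : ℕ → ℤ → ℤ → Set
TriangleCovered n a b =
  (x y : ℤ) → + 0 ≤ x → x < a → + 0 ≤ y → y < a - x → InCoverB n (a + b i) (x + y i)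

module _ {n : ℕ} {a b : ℤ} (0≤b : + 0 ≤ b) (b<a : b < a) (not-both-even : ¬ ((+ 2 ∣ a) × (+ 2 ∣ b)))
         (covered : TriangleCovered n a b) where

  -- The neighbour e − 1 lies in 𝒮; its lowest digit is forced to be 0, and raising it to 1 represents e.
  corner-rep : ∀ {e} → Corner a b e → + 0 ≤ im e → HasRepB n (a + b i) e
  corner-rep {x + y i} (x+y≡a , 2x≡a-b) 0≤y =
    from-neighbour (covered (x - + 1) y 0≤x-1 x-1<a 0≤y y<a-[x-1])
    where
    0<x : + 0 < x
    0<x = ℤ.*-cancelˡ-<-nonNeg (+ 2) (subst (+ 0 <_) (sym 2x≡a-b) (0<a-b 0≤b b<a))
    0≤x-1 : + 0 ≤ x - + 1
    0≤x-1 = i<j⇒0≤j-[1+i] 0<x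
    x-1<a : x - + 1 < a
    x-1<a = <-by-difference 0≤y (by-combination₁ (+ 1) x+y≡a (solve (a ∷ x ∷ y ∷ [])))
    y<a-[x-1] : y < a - (x - + 1)
    y<a-[x-1] = <-by-difference (0≤+ 0) (by-combination₁ (+ 1) x+y≡a (solve (a ∷ x ∷ y ∷ [])))
    from-neighbour : InCoverB n (a + b i) ((x - + 1) + y i) → HasRepB n (a + b i) (x + y i)
    from-neighbour (_ , z , (d Vec.∷ ds , refl) , eq)
      with corner-lowest-digit≡d0 {d = d} {evalDigits ds} {z} not-both-even x+y≡a 2x≡a-b eq
    ... | refl = evalDigits (d1 Vec.∷ ds) , z , (d1 Vec.∷ ds , refl) ,
                 raise-lowest-digit {evalDigits ds} {(a + b i) ⊗ z} eq

  quadrant-rep : ∀ {e} → InSquare a b e → + 0 ≤ re e → + 0 ≤ im e → HasRepB n (a + b i) e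
  quadrant-rep {x + y i} e∈square 0≤x 0≤y with x + y ℤ.<? a
  ... | no  x+y≮a = corner-rep (square-corner 0≤b b<a e∈square (ℤ.≮⇒≥ x+y≮a)) 0≤y
  ... | yes x+y<a =
    let x<a , y<a-x = below-diagonal 0≤y x+y<a
        β , z , β∈B , β+mz≡e = covered x y 0≤x x<a 0≤y y<a-x
    in β , z , β∈B , sym β+mz≡e

  square-rep : ∀ {e} → InSquare a b e → HasRepB n (a + b i) e
  square-rep {x + y i} e∈square with + 0 ℤ.≤? x | + 0 ℤ.≤? y
  ... | yes 0≤x | yes 0≤y = quadrant-rep e∈square 0≤x 0≤y
  ... | yes 0≤x | no  y≱0 = HasRepB-mulI⁻¹ (a + b i)
    (quadrant-rep (InSquare-mulI e∈square) (0≰i⇒0≤-i y≱0) 0≤x)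
  ... | no  x≱0 | no  y≱0 = HasRepB-mulI⁻¹ (a + b i) (HasRepB-mulI⁻¹ (a + b i)
    (quadrant-rep (InSquare-mulI (InSquare-mulI e∈square)) (0≰i⇒0≤-i x≱0) (0≰i⇒0≤-i y≱0)))
  ... | no  x≱0 | yes 0≤y =
    HasRepB-mulI⁻¹ (a + b i) (HasRepB-mulI⁻¹ (a + b i) (HasRepB-mulI⁻¹ (a + b i)
    (quadrant-rep (InSquare-mulI (InSquare-mulI (InSquare-mulI e∈square)))
                  (subst (+ 0 ≤_) (sym (ℤ.neg-involutive y)) 0≤y) (0≰i⇒0≤-i x≱0))))

mainTheorem13 : (n : ℕ) (a b : ℤ) → b < a → + 0 ≤ b → ¬ ((+ 2 ∣ a) × (+ 2 ∣ b))
    → ((x y : ℤ) → + 0 ≤ x → x < a → + 0 ≤ y → y < a - x → InCoverB n (a + b i) (x + y i))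
    → (w : ℤ[i]) → HasRepB n (a + b i) w
mainTheorem13 n a b b<a 0≤b not-both-even covered w =
  let e , q , e∈square , w≡e+mq = divide-into-square a b (0<norm 0≤b b<a) w
      e-rep = square-rep 0≤b b<a not-both-even covered e∈square
  in subst (HasRepB n (a + b i)) (sym w≡e+mq) (HasRepB-shift (a + b i) e-rep q)
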